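{- Let $B$ be a building set of a simplicial complex $C$ and let $N$ be a set. The following are equivalent: (1) $N\in\widetilde{\mathcal N}(C,B)$; (2) $N\subseteq B$, $\bigcup N\in C$, and every $N$-antichain misses $B$; (3) there is $\gamma\in C$ such that $N\in\widetilde{\mathcal N}(P(\gamma),B_\gamma)$; (4) there is a basis $\alpha$ of $C$ such that $N\in\widetilde{\mathcal N}(P(\alpha),B_\alpha)$.
   Context: A simplicial complex is a set $C=P(\alpha_1)\cup\ldots\cup P(\alpha_m)$, $m\geq1$, where $P(\cdot)$ denotes power set and the $\alpha_i$ are finite pairwise $\subseteq$-incomparable sets (the bases of $C$); for a finite set $\gamma$, $P(\gamma)$ is a simplicial complex with single basis $\gamma$. For a family $B$ and a set $\beta$, $B_\beta=B\cap P(\beta)$. A building set of $P(\gamma)$ is a set $B$ of nonempty subsets of $\gamma$ with (B1) $\beta,\delta\in B$, $\beta\cap\delta\ne\emptyset$ imply $\beta\cup\delta\in B$, and (B2) $\{a\}\in B$ for all $a\in\gamma$. A building set of $C$ with bases $\alpha_1,\ldots,\alpha_m$ is $B\subseteq C$ with each $B_{\alpha_i}$ a building set of $P(\alpha_i)$. For a family $N$, an $N$-antichain is a set $\{\beta_1,\ldots,\beta_t\}\subseteq N$, $t\geq2$, of pairwise $\subseteq$-incomparable sets; it misses $B$ if $\beta_1\cup\ldots\cup\beta_t\notin B$. For $B$ a building set of $C$, $N\subseteq B$ is nested if for every $N$-antichain $\{\beta_1,\ldots,\beta_t\}$, $\beta_1\cup\ldots\cup\beta_t\in C-B$; $\widetilde{\mathcal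 N}(C,B)$ is the simplicial complex of all nested subsets of $B$. -}

module Defs where

open import Level using (0ℓ)
open import Data.Nat using (ℕ; _≥_)
open import Data.Fin using (Fin)
open import Data.Fin.Subset using (Subset; _⊆_; _∈_; _∪_; _∩_; ⋃; ⁅_⁆; Nonempty)
open import Data.List using (List; []; _∷_; length)
open import Data.List.Membership.Propositional renaming (_∈_ to _∈ₗ_)
open import Data.List.Relation.Unary.All using (All)
open import Data.List.Relation.Unary.Any using (Any)
open import Data.List.Relation.Unary.AllPairs using (AllPairs)
open import Data.Product using (_×_; ∃)
open import Relation.Nullary using (¬_)
open import Relation.Unary using (Pred)

-- Vertices are elements of Fin n; finite sets of vertices are Subset n.
-- A family of sets is a predicate on Subset n; finite families (like N) are lists.

Incomparable : ∀ {n} → Subset n → Subset n → Set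
Incomparable x y = ¬ (x ⊆ y) × ¬ (y ⊆ x)

-- A list of sets is the basis list of a simplicial complex:
-- m ≥ 1 bases, pairwise ⊆-incomparable.
IsComplex : ∀ {n} → List (Subset n) → Set
IsComplex bases = (length bases ≥ 1) × AllPairs Incomparable bases

InC : ∀ {n} → List (Subset n) → Subset n → Set
InC bases x = Any (x ⊆_) bases

Restrict : ∀ {n} → Pred (Subset n) 0ℓ → Subset n → Pred (Subset n) 0ℓ
Restrict B β x = B x × x ⊆ β

IsBuildingSetOfPow : ∀ {n} → Subset n → Pred (Subset n) 0ℓ → Set
IsBuildingSetOfPow γ B =
  (∀ β → B β → Nonempty β × β ⊆ γ) ×
  (∀ β δ → B β → B δ → Nonempty (β ∩ δ) → B (β ∪ δ)) ×
  (∀ a → a ∈ γ → B ⁅ a ⁆)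

IsBuildingSet : ∀ {n} → List (Subset n) → Pred (Subset n) 0ℓ → Set
IsBuildingSet bases B =
  (∀ β → B β → InC bases β) ×
  All (λ α → IsBuildingSetOfPow α (Restrict B α)) bases

IsAntichain : ∀ {n} → List (Subset n) → List (Subset n) → Set
IsAntichain N A = (length A ≥ 2) × All (_∈ₗ N) A × AllPairs Incomparable A

Nested : ∀ {n} → List (Subset n) → Pred (Subset n) 0ℓ → List (Subset n) → Set
Nested bases B N =
  All B N ×
  (∀ A → IsAntichain N A → InC bases (⋃ A) × ¬ B (⋃ A))

-- The only non-trivial point is that ⋃ N ∈ C whenever N is nested. The maximal
-- elements of N have the same union as N; if there are at least two of them they
-- form an N-antichain, whose union lies in C by nestedness, and otherwise the union
-- is ∅ or a single member of N ⊆ B ⊆ C. Everything else follows from C being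
-- closed under subsets and the union of an N-antichain being contained in ⋃ N.
module Submission where

open import Defs
open import Level using (0ℓ)
open import Data.Nat using (ℕ; s≤s; z≤n)
open import Data.Fin.Subset using (Subset; ⋃; _⊆_; ⊥)
open import Data.Fin.Subset.Properties using (_⊆?_; ⊆-refl; ⊆-trans; ⊥⊆; p⊆p∪q; q⊆p∪q; x∈p∪q⁻)
open import Data.List using (List; _∷_; []; filter)
open import Data.List.Membership.Propositional using (_∈_; find; lose)
open import Data.List.Relation.Unary.All as All using (All; []; _∷_)
import Data.List.Relation.Unary.All.Properties as All
open import Data.List.Relation.Unary.Any as Any using (Any; here; there; any?)
import Data.List.Relation.Unary.Any.Properties as Any
open import Data.List.Relation.Unary.AllPairs using (AllPairs; []; _∷_)
import Data.List.Relation.Unary.AllPairs.Properties as AllPairs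
open import Data.Product using (_×_; Σ; _,_; proj₁; proj₂)
open import Data.Sum using ([_,_]; inj₁; inj₂)
open import Function using (_∘_; _∘₂_)
open import Function.Bundles using (_⇔_; mk⇔)
open import Relation.Nullary using (¬_; yes; no)
open import Relation.Nullary.Decidable using (¬?; decidable-stable)
open import Relation.Unary using (Pred; Decidable)
open import Relation.Binary.PropositionalEquality using (refl)

private
  variable
    n : ℕ
    C A N : List (Subset n)
    x y γ : Subset n
    B : Pred (Subset n) 0ℓ

⊆-⋃ : y ∈ A → y ⊆ ⋃ A
⊆-⋃ {A = a ∷ A} (here refl) = p⊆p∪q (⋃ A)
⊆-⋃ {A = a ∷ A} (there y∈A) = ⊆-trans (⊆-⋃ y∈A) (q⊆p∪q a (⋃ A))

⋃-least : All (_⊆ x) A → ⋃ A ⊆ x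
⋃-least [] = ⊥⊆
⋃-least {A = a ∷ A} (a⊆x ∷ A⊆x) p = [ a⊆x , ⋃-least A⊆x ] (x∈p∪q⁻ a (⋃ A) p)

⋃-mono-InC : All (InC C) A → ⋃ A ⊆ ⋃ C
⋃-mono-InC = ⋃-least ∘ All.map InC⇒⊆⋃
  where
  InC⇒⊆⋃ : InC C y → y ⊆ ⋃ C
  InC⇒⊆⋃ y∈C with find y∈C
  ... | _ , c∈C , y⊆c = ⊆-trans y⊆c (⊆-⋃ c∈C)

⋃-antichain⊆⋃ : IsAntichain N A → ⋃ A ⊆ ⋃ N
⋃-antichain⊆⋃ (_ , A⊆N , _) = ⋃-least (All.map ⊆-⋃ A⊆N)

InC-⊆ : x ⊆ y → InC C y → InC C x
InC-⊆ x⊆y = Any.map (⊆-trans x⊆y)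

∈⇒InC : x ∈ C → InC C x
∈⇒InC x∈C = lose x∈C ⊆-refl

InC-[]⇒⊆ : InC (γ ∷ []) x → x ⊆ γ
InC-[]⇒⊆ (here x⊆γ) = x⊆γ

⊥-InC : IsComplex C → InC C ⊥
⊥-InC {C = _ ∷ _} _ = here ⊥⊆

record Maxima (N : List (Subset n)) : Set where
  field
    elements : List (Subset n)
    elements⊆N : All (_∈ N) elements
    antichain : AllPairs Incomparable elements
    dominate : All (InC elements) N

maxima : (N : List (Subset n)) → Maxima N
maxima [] = record { elements = [] ; elements⊆N = [] ; antichain = [] ; dominate = [] }
maxima (x ∷ N) with maxima N
... | record { elements = M ; elements⊆N = M⊆N ; antichain = M-antichain ; dominate = N≤M }
  with any? (x ⊆?_) M
... | yes x≤M = record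
  { elements = M ; elements⊆N = All.map there M⊆N ; antichain = M-antichain ; dominate = x≤M ∷ N≤M }
... | no x≰M = record
  { elements = x ∷ M′
  ; elements⊆N = here refl ∷ All.filter⁺ notBelow? (All.map there M⊆N)
  ; antichain = All.zip (All.filter⁺ notBelow? (All.tabulate x⊈) , All.all-filter notBelow? M)
                ∷ AllPairs.filter⁺ notBelow? M-antichain
  ; dominate = here ⊆-refl ∷ All.map InC-cons-filter N≤M
  }
  where
  notBelow? : Decidable λ m → ¬ m ⊆ x
  notBelow? m = ¬? (m ⊆? x)
  M′ : List (Subset _)
  M′ = filter notBelow? M
  x⊈ : ∀ {m} → m ∈ M → ¬ x ⊆ m
  x⊈ m∈M x⊆m = x≰M (lose m∈M x⊆m)
  -- An element of M that is dropped lies below x, so x takes over its role.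
  InC-cons-filter : InC M y → InC (x ∷ M′) y
  InC-cons-filter y≤M with Any.filter⁺ notBelow? y≤M
  ... | inj₁ y≤M′ = there y≤M′
  ... | inj₂ m⊆x = here (⊆-trans (Any.lookup-result y≤M) (decidable-stable (_ ⊆? x) m⊆x))

⋃-InC : IsComplex C → All (InC C) N → (∀ A → IsAntichain N A → InC C (⋃ A)) → InC C (⋃ N)
⋃-InC {N = N} complex N⊆C antichain-InC with maxima N
... | record { elements = [] ; dominate = N≤M } =
  InC-⊆ (⋃-mono-InC N≤M) (⊥-InC complex)
... | record { elements = m ∷ [] ; elements⊆N = m∈N ∷ [] ; dominate = N≤M } =
  InC-⊆ (⋃-least (All.map (InC-[]⇒⊆ {γ = m}) N≤M)) (All.lookup N⊆C m∈N)
... | record { elements = M@(_ ∷ _ ∷ _) ; elements⊆N = M⊆N ; antichain = M-antichain ; dominate = N≤M } =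
  InC-⊆ (⋃-mono-InC N≤M) (antichain-InC M (s≤s (s≤s z≤n) , M⊆N , M-antichain))

Nested-restrict : ⋃ N ⊆ γ → Nested C B N → Nested (γ ∷ []) (Restrict B γ) N
Nested-restrict ⋃N⊆γ (N⊆B , nested) =
  All.zip (N⊆B , All.tabulate {P = _⊆ _} (λ x∈N → ⊆-trans (⊆-⋃ x∈N) ⋃N⊆γ))
  , λ A A-antichain → here (⊆-trans (⋃-antichain⊆⋃ A-antichain) ⋃N⊆γ)
                    , proj₂ (nested A A-antichain) ∘ proj₁

Nested-unrestrict : InC C γ → Nested (γ ∷ []) (Restrict B γ) N → Nested C B N
Nested-unrestrict γ∈C (N⊆Bγ , nested) =
  All.map proj₁ N⊆Bγ
  , λ A A-antichain → let (⋃A∈Pγ , ⋃A∉Bγ) = nested A A-antichain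
                          ⋃A⊆γ = InC-[]⇒⊆ ⋃A∈Pγ
                      in InC-⊆ ⋃A⊆γ γ∈C , λ ⋃A∈B → ⋃A∉Bγ (⋃A∈B , ⋃A⊆γ)

proposition3p2 : ∀ {n : ℕ} (bases : List (Subset n)) (B : Pred (Subset n) 0ℓ)
    → IsComplex bases → IsBuildingSet bases B → (N : List (Subset n))
    → (Nested bases B N ⇔ (All B N × InC bases (⋃ N) × (∀ A → IsAntichain N A → ¬ B (⋃ A))))
    × (Nested bases B N ⇔ (Σ (Subset n) λ γ → InC bases γ × Nested (γ ∷ []) (Restrict B γ) N))
    × (Nested bases B N ⇔ (Σ (Subset n) λ α → α ∈ bases × Nested (α ∷ []) (Restrict B α) N))
proposition3p2 bases B complex (B⊆C , _) N =
  mk⇔ (λ nest@(N⊆B , nested) → N⊆B , ⋃N∈C nest , proj₂ ∘₂ nested)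
      (λ (N⊆B , ⋃N∈C , missing) → N⊆B , λ A a → InC-⊆ (⋃-antichain⊆⋃ a) ⋃N∈C , missing A a)
  , mk⇔ (λ nest → ⋃ N , ⋃N∈C nest , Nested-restrict ⊆-refl nest)
        (λ (γ , γ∈C , nest) → Nested-unrestrict γ∈C nest)
  , mk⇔ (λ nest → let (α , α∈C , ⋃N⊆α) = find (⋃N∈C nest)
                  in α , α∈C , Nested-restrict ⋃N⊆α nest)
        (λ (α , α∈C , nest) → Nested-unrestrict (∈⇒InC α∈C) nest)
  where
  ⋃N∈C : Nested bases B N → InC bases (⋃ N)
  ⋃N∈C (N⊆B , nested) = ⋃-InC complex (All.map (B⊆C _) N⊆B) (λ A a → proj₁ (nested A a))
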